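{- Let $n\ge 2$ and let $S,T$ be nonempty subsets of $\{1,\ldots,n-1\}$ with $\max S+\min T\le n$ and $\min S+\max T\le n$. Let $D$ be the digraph of the Boolean Toeplitz matrix $T_n\langle S;T\rangle$, let $s_1=\min S$, $d=\gcd\{s+t\mid s\in S,\ t\in T\}$, and $d'=\gcd(d,s_1)$. Then (a) the matrix period of $D$ is $d/d'$; (b) the competition period of $D$ is $1$; (c) the sequence $\{C^m(D)\}_{m=1}^\infty$ is eventually constant, and for all sufficiently large $m$ the graph $C^m(D)$ is the disjoint union of the cliques $\{v\in[n]\mid v\equiv i \pmod d\}$, $1\le i\le d$ (i.e. two distinct vertices are adjacent iff they are congruent modulo $d$).
   Context: Boolean arithmetic on $\mathbb{B}=\{0,1\}$: $1+1=1$, otherwise usual $+$ and $\cdot$. For nonempty $S,T\subseteq\{1,\ldots,n-1\}$, $T_n\langle S;T\rangle$ is the $n\times n$ Boolean matrix whose $(i,j)$-entry is $1$ iff $j-i\in S$ or $i-j\in T$. Its digraph $D$ has vertex set $[n]=\{1,\ldots,n\}$ and an arc $(i,j)$ iff the $(i,j)$-entry is $1$ (so for $i<j$, $(i,j)$ is an arc iff $j-i\in S$; for $i>j$, iff $i-j\in T$). For a Boolean matrix $A$, the matrix period is the smallest positive integer $p$ such that there is $M$ with $A^m=A^{m+p}$ for all $m\ge M$. The competition index of $A$ is the smallest positive integer $q$ such that for some positive integer $r$, $A^{q+i}(A^T)^{q+i}=A^{q+r+i}(A^T)^{q+r+i}$ for every integer $i\ge0$; the competition period is then the smallest positive integer $p$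 with $A^q(A^T)^q=A^{q+p}(A^T)^{q+p}$. The matrix period / competition period of a digraph means that of its adjacency matrix. For a positive integer $m$, the $m$-step competition graph $C^m(D)$ is the (simple) graph on the vertex set of $D$ in which distinct $u,v$ are adjacent iff there is a vertex $w$ with a directed $(u,w)$-walk of length $m$ and a directed $(v,w)$-walk of length $m$ in $D$. -}

module Defs where

open import Data.Nat using (ℕ; zero; suc; _+_; _*_; _≤_; _<_; _≡ᵇ_; _⊓_; _⊔_)
open import Data.Nat.GCD using (gcd)
open import Data.Bool using (Bool; true; false; _∧_; _∨_; T)
open import Data.Fin using (Fin; toℕ)
open import Data.Fin.Properties using () renaming (_≟_ to _≟ᶠ_)
open import Data.Bool.ListAction using (any)
open import Data.List using (List; allFin; map; concatMap; foldr)
open import Data.List.NonEmpty using (List⁺; toList; foldr₁)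
open import Data.Product using (Σ; _×_; ∃; ∃-syntax)
open import Relation.Binary.PropositionalEquality using (_≡_)
open import Relation.Nullary using (¬_; does)

-- Finite sets of naturals are given as nonempty lists (order and
-- repetitions are irrelevant for everything defined below).

minSet : List⁺ ℕ → ℕ
minSet = foldr₁ _⊓_

maxSet : List⁺ ℕ → ℕ
maxSet = foldr₁ _⊔_

-- gcd of a finite set of naturals (gcd of the empty set is 0)
gcdList : List ℕ → ℕ
gcdList = foldr gcd 0

sumSet : List⁺ ℕ → List⁺ ℕ → List ℕ
sumSet S T = concatMap (λ s → map (s +_) (toList T)) (toList S)

-- Boolean matrices (indices 0..n-1 stand for vertices 1..n)

Mat : ℕ → Set
Mat n = Fin n → Fin n → Bool

_≋_ : ∀ {n} → Mat n → Mat n → Set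
A ≋ B = ∀ i j → A i j ≡ B i j

infix 4 _≋_

_⊗_ : ∀ {n} → Mat n → Mat n → Mat n
_⊗_ {n} A B i j = any (λ k → A i k ∧ B k j) (allFin n)

infixl 7 _⊗_

idMat : ∀ {n} → Mat n
idMat i j = does (i ≟ᶠ j)

_^ᴹ_ : ∀ {n} → Mat n → ℕ → Mat n
A ^ᴹ zero = idMat
A ^ᴹ suc m = A ⊗ (A ^ᴹ m)

infixr 8 _^ᴹ_

transpose : ∀ {n} → Mat n → Mat n
transpose A i j = A j i

toeplitz : (n : ℕ) → List⁺ ℕ → List⁺ ℕ → Mat n
toeplitz n S T i j =
  any (λ s → (toℕ i + s) ≡ᵇ toℕ j) (toList S) ∨
  any (λ t → (toℕ j + t) ≡ᵇ toℕ i) (toList T)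

EventuallyPeriodic : ∀ {n} → Mat n → ℕ → Set
EventuallyPeriodic A p = ∃[ M ] (∀ m → M ≤ m → A ^ᴹ m ≋ A ^ᴹ (m + p))

MatrixPeriod : ∀ {n} → Mat n → ℕ → Set
MatrixPeriod A p =
  0 < p × EventuallyPeriodic A p ×
  (∀ p′ → 0 < p′ → EventuallyPeriodic A p′ → p ≤ p′)

compMat : ∀ {n} → Mat n → ℕ → Mat n
compMat A k = (A ^ᴹ k) ⊗ (transpose A ^ᴹ k)

CompIndexCond : ∀ {n} → Mat n → ℕ → Set
CompIndexCond A q =
  ∃[ r ] (0 < r × (∀ i → compMat A (q + i) ≋ compMat A (q + r + i)))

CompetitionIndex : ∀ {n} → Mat n → ℕ → Set
CompetitionIndex A q =
  0 < q × CompIndexCond A q × (∀ q′ → 0 < q′ → CompIndexCond A q′ → q ≤ q′)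

CompetitionPeriod : ∀ {n} → Mat n → ℕ → Set
CompetitionPeriod A p =
  ∃[ q ] (CompetitionIndex A q ×
          0 < p × compMat A q ≋ compMat A (q + p) ×
          (∀ p′ → 0 < p′ → compMat A q ≋ compMat A (q + p′) → p ≤ p′))

data Walk {n} (A : Mat n) : ℕ → Fin n → Fin n → Set where
  stop : ∀ {u} → Walk A zero u u
  step : ∀ {m u x w} → T (A u x) → Walk A m x w → Walk A (suc m) u w

CompAdj : ∀ {n} → Mat n → ℕ → Fin n → Fin n → Set
CompAdj A m u v = ¬ (u ≡ v) × ∃[ w ] (Walk A m u w × Walk A m v w)

-- Write s₁ = min S, t₁ = min T, N₀ = s₁ + t₁ and d = gcd {s + t}.  Every arc i → j of D
-- satisfies j ≡ i + s₁ (mod d), since s ≡ s₁ and -t ≡ s₁ modulo d, so a walk of length m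
-- from i ends in the class of i + m s₁.  Conversely, for all large m every vertex of that
-- class is the end of such a walk.  Steps +s₁ and -t₁ can zigzag forever inside any window
-- of N₀ consecutive vertices, where the class modulo N₀ pins down the vertex; excursions
-- through the other arcs shift that class by s + t₁ and by -(s₁ + t); the realisable
-- shifts form a subgroup of ℤ/N₀ℤ, so they contain every s + t and hence d.  So for large m,
-- (Aᵐ)ᵢⱼ = 1 iff j ≡ i + m s₁ (mod d), an m-periodic condition of period d / gcd(d, s₁),
-- and i, j have a common m-step out-neighbour iff i ≡ j (mod d), whatever m.

module Submission where

open import Defs
open import Data.Nat
open import Data.Nat.Properties
open import Data.Nat.Divisibility using (_∣_; divides; ∣m+n∣m⇒∣n; n∣m*n; ∣-trans; ∣⇒≤; 0∣⇒≡0; *-cancelʳ-∣)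
open import Data.Nat.DivMod using (_%_; _/_; [m+kn]%n≡m%n; m<n⇒m%n≡m; m≡m%n+[m/n]*n; m%n<n; m/n*n≡m)
open import Data.Nat.GCD using (gcd; gcd[m,n]∣m; gcd[m,n]∣n; gcd[m,n]≢0; gcd-GCD; module Bézout)
open import Data.Nat.Coprimality using (coprime-/gcd; coprime-divisor)
open import Data.Nat.Tactic.RingSolver using (solve-∀)
open import Algebra.Properties.CommutativeSemigroup +-commutativeSemigroup using (xy∙z≈xz∙y; interchange)
open import Data.Bool using (Bool; T)
import Data.Bool as Bool
open import Data.Bool.ListAction using (any)
open import Data.Bool.Properties using (T-∧; T-∨; T-≡; ⇔→≡) renaming (_≟_ to _≟ᴮ_)
open import Data.Fin using (Fin; toℕ; fromℕ<)
open import Data.Fin.Properties using (all?; toℕ-fromℕ<; toℕ-injective; toℕ<n) renaming (_≟_ to _≟ᶠ_)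
open import Data.List using ([]; _∷_; map; allFin)
open import Data.List.NonEmpty using (List⁺; _∷_; toList)
open import Data.List.Relation.Unary.All as All using (All; []; _∷_)
open import Data.List.Relation.Unary.Any using (here; there)
open import Data.List.Relation.Unary.Any.Properties using (any⁺; any⁻)
open import Data.List.Membership.Propositional using (_∈_; find; lose)
open import Data.List.Membership.Propositional.Properties using (∈-allFin; ∈-map⁺; ∈-map⁻; ∈-concatMap⁺; ∈-concatMap⁻)
open import Data.Product using (∃; ∃₂; ∃-syntax; _×_; _,_; proj₁; proj₂)
open import Data.Product.Function.NonDependent.Propositional using (_×-⇔_)
open import Data.Sum using (_⊎_; inj₁; inj₂; [_,_]′)
open import Function.Bundles using (_⇔_; mk⇔; Equivalence)
open import Function.Properties.Equivalence using (⇔-isEquivalence)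
open import Relation.Binary.Bundles using (Setoid)
open import Relation.Binary.Structures using (IsEquivalence)
open import Relation.Binary.PropositionalEquality
import Relation.Binary.Reasoning.Setoid as SetoidReasoning
open import Relation.Nullary using (¬_; yes; no; contradiction)
open import Relation.Unary using (Decidable)

open Equivalence using (to; from)
private module ⇔ {ℓ} = IsEquivalence (⇔-isEquivalence {ℓ})

-- Congruence on ℕ stated without subtraction: x + aN = y + bN for some a, b.
_≡_[mod_] : ℕ → ℕ → ℕ → Set
x ≡ y [mod N ] = ∃₂ λ a b → x + a * N ≡ y + b * N

infix 4 _≡_[mod_]

module _ {N : ℕ} where

  mod-reflexive : ∀ {x y} → x ≡ y → x ≡ y [mod N ]
  mod-reflexive refl = 0 , 0 , refl

  mod-refl : ∀ {x} → x ≡ x [mod N ]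
  mod-refl = mod-reflexive refl

  mod-sym : ∀ {x y} → x ≡ y [mod N ] → y ≡ x [mod N ]
  mod-sym (a , b , e) = b , a , sym e

  mod-trans : ∀ {x y z} → x ≡ y [mod N ] → y ≡ z [mod N ] → x ≡ z [mod N ]
  mod-trans {x} {y} {z} (a , b , e) (c , d , f) = a + c , b + d , (begin
    x + (a + c) * N      ≡⟨ +-*-distrib x a c ⟩
    x + a * N + c * N    ≡⟨ cong (_+ c * N) e ⟩
    y + b * N + c * N    ≡⟨ xy∙z≈xz∙y y (b * N) (c * N) ⟩
    y + c * N + b * N    ≡⟨ cong (_+ b * N) f ⟩
    z + d * N + b * N    ≡⟨ xy∙z≈xz∙y z (d * N) (b * N) ⟩
    z + b * N + d * N    ≡⟨ +-*-distrib z b d ⟨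
    z + (b + d) * N      ∎)
    where
    open ≡-Reasoning
    +-*-distrib : ∀ x a b → x + (a + b) * N ≡ x + a * N + b * N
    +-*-distrib x a b = trans (cong (x +_) (*-distribʳ-+ N a b)) (sym (+-assoc x (a * N) (b * N)))

  mod-isEquivalence : IsEquivalence (_≡_[mod N ])
  mod-isEquivalence = record { refl = mod-refl ; sym = mod-sym ; trans = mod-trans }

  +-cong-mod : ∀ {x y u v} → x ≡ y [mod N ] → u ≡ v [mod N ] → x + u ≡ y + v [mod N ]
  +-cong-mod {x} {y} {u} {v} (a , b , e) (c , d , f) = a + c , b + d , (begin
    x + u + (a + c) * N        ≡⟨ cong (x + u +_) (*-distribʳ-+ N a c) ⟩
    x + u + (a * N + c * N)    ≡⟨ interchange x u (a * N) (c * N) ⟩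
    x + a * N + (u + c * N)    ≡⟨ cong₂ _+_ e f ⟩
    y + b * N + (v + d * N)    ≡⟨ interchange y (b * N) v (d * N) ⟩
    y + v + (b * N + d * N)    ≡⟨ cong (y + v +_) (*-distribʳ-+ N b d) ⟨
    y + v + (b + d) * N        ∎)
    where open ≡-Reasoning

  +-congˡ-mod : ∀ c {x y} → x ≡ y [mod N ] → c + x ≡ c + y [mod N ]
  +-congˡ-mod c = +-cong-mod mod-refl

  +-congʳ-mod : ∀ c {x y} → x ≡ y [mod N ] → x + c ≡ y + c [mod N ]
  +-congʳ-mod c p = +-cong-mod p mod-refl

  *-congˡ-mod : ∀ k {x y} → x ≡ y [mod N ] → k * x ≡ k * y [mod N ]
  *-congˡ-mod k {x} {y} (a , b , e) = k * a , k * b , (begin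
    k * x + k * a * N    ≡⟨ *-+-multiple x a ⟨
    k * (x + a * N)      ≡⟨ cong (k *_) e ⟩
    k * (y + b * N)      ≡⟨ *-+-multiple y b ⟩
    k * y + k * b * N    ∎)
    where
    open ≡-Reasoning
    *-+-multiple : ∀ x a → k * (x + a * N) ≡ k * x + k * a * N
    *-+-multiple x a = trans (*-distribˡ-+ k x (a * N)) (cong (k * x +_) (sym (*-assoc k a N)))

  *-congʳ-mod : ∀ k {x y} → x ≡ y [mod N ] → x * k ≡ y * k [mod N ]
  *-congʳ-mod k {x} {y} p =
    subst₂ (_≡_[mod N ]) (*-comm k x) (*-comm k y) (*-congˡ-mod k p)

  +-cancelʳ-mod : ∀ c {x y} → x + c ≡ y + c [mod N ] → x ≡ y [mod N ]
  +-cancelʳ-mod c {x} {y} (a , b , e) = a , b , +-cancelʳ-≡ c _ _ (begin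
    x + a * N + c  ≡⟨ xy∙z≈xz∙y x (a * N) c ⟩
    x + c + a * N  ≡⟨ e ⟩
    y + c + b * N  ≡⟨ xy∙z≈xz∙y y c (b * N) ⟩
    y + b * N + c  ∎)
    where open ≡-Reasoning

  +-cancelˡ-mod : ∀ c {x y} → c + x ≡ c + y [mod N ] → x ≡ y [mod N ]
  +-cancelˡ-mod c {x} {y} p =
    +-cancelʳ-mod c (mod-trans (mod-reflexive (+-comm x c)) (mod-trans p (mod-reflexive (+-comm c y))))

  +-multiple-mod : ∀ x k → x + k * N ≡ x [mod N ]
  +-multiple-mod x k = 0 , k , +-identityʳ _

  +-modulus-mod : ∀ x → x + N ≡ x [mod N ]
  +-modulus-mod x = 0 , 1 , trans (+-identityʳ (x + N)) (cong (x +_) (sym (+-identityʳ N)))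

  ∣⇒≡0-mod : ∀ {x} → N ∣ x → x ≡ 0 [mod N ]
  ∣⇒≡0-mod {x} (divides q e) = 0 , q , trans (+-identityʳ x) e

  ≡0-mod⇒∣ : ∀ {x} → x ≡ 0 [mod N ] → N ∣ x
  ≡0-mod⇒∣ {x} (a , b , e) =
    ∣m+n∣m⇒∣n (subst (N ∣_) (trans (sym e) (+-comm x (a * N))) (n∣m*n b)) (n∣m*n a)

  ≡-mod⇒∣∣-∣ : ∀ {x y} → x ≡ y [mod N ] → N ∣ ∣ x - y ∣
  ≡-mod⇒∣∣-∣ {x} {y} p with ≤-total x y
  ... | inj₁ x≤y = subst (N ∣_) (sym (m≤n⇒∣m-n∣≡n∸m x≤y))
        (≡0-mod⇒∣ (+-cancelʳ-mod x (mod-trans (mod-reflexive (m∸n+n≡m x≤y)) (mod-sym p))))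
  ... | inj₂ y≤x = subst (N ∣_) (sym (trans (∣-∣-comm x y) (m≤n⇒∣m-n∣≡n∸m y≤x)))
        (≡0-mod⇒∣ (+-cancelʳ-mod y (mod-trans (mod-reflexive (m∸n+n≡m y≤x)) p)))

  ∣∣-∣⇒≡-mod : ∀ {x y} → N ∣ ∣ x - y ∣ → x ≡ y [mod N ]
  ∣∣-∣⇒≡-mod {x} {y} h with ≤-total x y
  ... | inj₁ x≤y = mod-sym (mod-trans (mod-reflexive (sym (m∸n+n≡m x≤y)))
        (+-congʳ-mod x (∣⇒≡0-mod (subst (N ∣_) (m≤n⇒∣m-n∣≡n∸m x≤y) h))))
  ... | inj₂ y≤x = mod-trans (mod-reflexive (sym (m∸n+n≡m y≤x))) (+-congʳ-mod y
        (∣⇒≡0-mod (subst (N ∣_) (trans (∣-∣-comm x y) (m≤n⇒∣m-n∣≡n∸m y≤x)) h)))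

mod-setoid : ℕ → Setoid _ _
mod-setoid N = record { isEquivalence = mod-isEquivalence {N} }

module ≡-mod-Reasoning (N : ℕ) = SetoidReasoning (mod-setoid N)

%-mod : ∀ x N .{{_ : NonZero N}} → x % N ≡ x [mod N ]
%-mod x N = x / N , 0 , trans (sym (m≡m%n+[m/n]*n x N)) (sym (+-identityʳ x))

+-pred*-≡0-mod : ∀ {N} .{{_ : NonZero N}} x → x + pred N * x ≡ 0 [mod N ]
+-pred*-≡0-mod {N} x = 0 , x , (begin
  x + pred N * x + 0  ≡⟨ +-identityʳ _ ⟩
  suc (pred N) * x    ≡⟨ cong (_* x) (suc-pred N) ⟩
  N * x               ≡⟨ *-comm N x ⟩
  x * N               ∎)
  where open ≡-Reasoning

−-as-+-mod : ∀ {N} .{{_ : NonZero N}} {u a x} → u + a ≡ x [mod N ] → u ≡ x + pred N * a [mod N ]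
−-as-+-mod {N} {u} {a} {x} p = begin
  u                           ≈⟨ mod-sym (+-multiple-mod u a) ⟩
  u + a * N                   ≡⟨ cong (λ k → u + a * k) (suc-pred N) ⟨
  u + a * suc (pred N)        ≡⟨ cong (u +_) (*-suc a (pred N)) ⟩
  u + (a + a * pred N)        ≡⟨ +-assoc u a _ ⟨
  (u + a) + a * pred N        ≡⟨ cong (u + a +_) (*-comm a (pred N)) ⟩
  (u + a) + pred N * a        ≈⟨ +-congʳ-mod (pred N * a) p ⟩
  x + pred N * a              ∎
  where open ≡-mod-Reasoning N

≡-mod-unique : ∀ {N x y} → x < N → y < N → x ≡ y [mod N ] → x ≡ y
≡-mod-unique {N@(suc _)} {x} {y} x<N y<N (a , b , e) = begin
  x                ≡⟨ m<n⇒m%n≡m x<N ⟨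
  x % N            ≡⟨ [m+kn]%n≡m%n x a N ⟨
  (x + a * N) % N  ≡⟨ cong (_% N) e ⟩
  (y + b * N) % N  ≡⟨ [m+kn]%n≡m%n y b N ⟩
  y % N            ≡⟨ m<n⇒m%n≡m y<N ⟩
  y                ∎
  where open ≡-Reasoning

≡-mod-unique-in-window : ∀ {N c y y′} → c ≤ y → y < c + N → c ≤ y′ → y′ < c + N →
                         y ≡ y′ [mod N ] → y ≡ y′
≡-mod-unique-in-window {N} {c} {y} {y′} c≤y y<c+N c≤y′ y′<c+N y≡y′ = begin
  y             ≡⟨ m∸n+n≡m c≤y ⟨
  y ∸ c + c     ≡⟨ cong (_+ c) offsets≡ ⟩
  y′ ∸ c + c    ≡⟨ m∸n+n≡m c≤y′ ⟩
  y′            ∎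
  where
  open ≡-Reasoning
  offset< : ∀ {z} → c ≤ z → z < c + N → z ∸ c < N
  offset< {z} c≤z z<c+N = +-cancelˡ-< c _ _ (subst (_< c + N) (sym (m+[n∸m]≡n c≤z)) z<c+N)
  offsets≡ : y ∸ c ≡ y′ ∸ c
  offsets≡ = ≡-mod-unique (offset< c≤y y<c+N) (offset< c≤y′ y′<c+N) (+-cancelʳ-mod c
    (subst₂ (_≡_[mod N ]) (sym (m∸n+n≡m c≤y)) (sym (m∸n+n≡m c≤y′)) y≡y′))

minSet-∈ : ∀ L → minSet L ∈ toList L
minSet-∈ (x ∷ xs) = go x xs
  where
  go : ∀ x xs → minSet (x ∷ xs) ∈ x ∷ xs
  go x [] = here refl
  go x (y ∷ ys) = [ here , (λ eq → there (subst (_∈ y ∷ ys) (sym eq) (go y ys))) ]′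
                    (⊓-sel x (minSet (y ∷ ys)))

≤-maxSet : ∀ L {s} → s ∈ toList L → s ≤ maxSet L
≤-maxSet (x ∷ xs) = go x xs
  where
  go : ∀ x xs {s} → s ∈ x ∷ xs → s ≤ maxSet (x ∷ xs)
  go x [] (here refl) = ≤-refl
  go x (y ∷ ys) (here refl) = m≤m⊔n x _
  go x (y ∷ ys) (there s∈) = ≤-trans (go y ys s∈) (m≤n⊔m x _)

gcdList-∣ : ∀ xs → All (gcdList xs ∣_) xs
gcdList-∣ [] = []
gcdList-∣ (x ∷ xs) = gcd[m,n]∣m x (gcdList xs) ∷
  All.map (∣-trans (gcd[m,n]∣n x (gcdList xs))) (gcdList-∣ xs)

∈-sumSet⁺ : ∀ {S T s t} → s ∈ toList S → t ∈ toList T → s + t ∈ sumSet S T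
∈-sumSet⁺ {T = T} s∈ t∈ =
  ∈-concatMap⁺ (λ s → map (s +_) (toList T)) (lose s∈ (∈-map⁺ (_ +_) t∈))

∈-sumSet⁻ : ∀ {S T v} → v ∈ sumSet S T →
            ∃₂ λ s t → s ∈ toList S × t ∈ toList T × v ≡ s + t
∈-sumSet⁻ {S} {T} v∈ with find (∈-concatMap⁻ (λ s → map (s +_) (toList T)) {xs = toList S} v∈)
... | s , s∈ , v∈map with ∈-map⁻ (s +_) v∈map
...   | t , t∈ , refl = s , t , s∈ , t∈ , refl

-- Bézout's identity writes a gcd as a difference, and modulo N a difference is a sum.
module GcdClosed {N : ℕ} .{{_ : NonZero N}} (P : ℕ → Set) (P-0 : P 0)
  (P-+ : ∀ {a b} → P a → P b → P (a + b))
  (P-resp : ∀ {a b} → a ≡ b [mod N ] → P a → P b) where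

  P-* : ∀ k {a} → P a → P (k * a)
  P-* zero _ = P-0
  P-* (suc k) pa = P-+ pa (P-* k pa)

  P-∸ : ∀ {g u v} → g + u ≡ v → P u → P v → P g
  P-∸ eq pu pv =
    P-resp (mod-sym (−-as-+-mod (mod-reflexive eq))) (P-+ pv (P-* (pred N) pu))

  P-neg : ∀ {a b} → a + b ≡ 0 [mod N ] → P b → P a
  P-neg a+b≡0 pb = P-∸ refl pb (P-resp (mod-sym a+b≡0) P-0)

  P-gcd : ∀ {a b} → P a → P b → P (gcd a b)
  P-gcd {a} {b} pa pb with Bézout.identity (gcd-GCD a b)
  ... | Bézout.+- x y eq = P-∸ eq (P-* y pb) (P-* x pa)
  ... | Bézout.-+ x y eq = P-∸ eq (P-* x pa) (P-* y pb)

  P-gcdList : ∀ {xs} → All P xs → P (gcdList xs)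
  P-gcdList [] = P-0
  P-gcdList (px ∷ pxs) = P-gcd px (P-gcdList pxs)

T-any⇔∃∈ : ∀ {a} {A : Set a} (p : A → Bool) xs → T (any p xs) ⇔ ∃ λ x → x ∈ xs × T (p x)
T-any⇔∃∈ p xs = mk⇔ (λ h → find (any⁻ p xs h)) (λ (x , x∈ , px) → any⁺ p (lose x∈ px))

T-anyFin : ∀ {n} (f : Fin n → Bool) → T (any f (allFin n)) ⇔ ∃ λ k → T (f k)
T-anyFin {n} f = mk⇔ (λ h → let k , _ , fk = to (T-any⇔∃∈ f (allFin n)) h in k , fk)
                     (λ (k , fk) → from (T-any⇔∃∈ f (allFin n)) (k , ∈-allFin k , fk))

T-⊗ : ∀ {n} (A B : Mat n) i j → T ((A ⊗ B) i j) ⇔ ∃ λ k → T (A i k) × T (B k j)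
T-⊗ A B i j = mk⇔
  (λ h → let k , p = to (T-anyFin _) h in k , to T-∧ p)
  (λ (k , p) → from (T-anyFin _) (k , from T-∧ p))

module _ {n} {A : Mat n} where

  walk-snoc : ∀ {m u w z} → Walk A m u w → T (A w z) → Walk A (suc m) u z
  walk-snoc stop a = step a stop
  walk-snoc (step b w) a = step b (walk-snoc w a)

  walk-reverse : ∀ {m u w} → Walk (transpose A) m u w → Walk A m w u
  walk-reverse stop = stop
  walk-reverse (step a w) = walk-snoc (walk-reverse w) a

T-^ᴹ⇔Walk : ∀ {n} (A : Mat n) m i j → T ((A ^ᴹ m) i j) ⇔ Walk A m i j
T-^ᴹ⇔Walk A m i j = mk⇔ (toWalk m i j) (fromWalk m i j)
  where
  toWalk : ∀ m i j → T ((A ^ᴹ m) i j) → Walk A m i j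
  toWalk zero i j h with i ≟ᶠ j
  ... | yes refl = stop
  toWalk (suc m) i j h = let k , a , w = to (T-⊗ A (A ^ᴹ m) i j) h in step a (toWalk m k j w)
  fromWalk : ∀ m i j → Walk A m i j → T ((A ^ᴹ m) i j)
  fromWalk zero i i stop with i ≟ᶠ i
  ... | yes _ = _
  ... | no i≢i = i≢i refl
  fromWalk (suc m) i j (step {x = k} a w) = from (T-⊗ A (A ^ᴹ m) i j) (k , a , fromWalk m k j w)

T-compMat⇔commonEnd : ∀ {n} (A : Mat n) m i j →
                      T (compMat A m i j) ⇔ ∃ λ k → Walk A m i k × Walk A m j k
T-compMat⇔commonEnd A m i j = mk⇔
  (λ h → let k , a , b = to (T-⊗ (A ^ᴹ m) (transpose A ^ᴹ m) i j) h
         in k , to (T-^ᴹ⇔Walk A m i k) a , walk-reverse (to (T-^ᴹ⇔Walk (transpose A) m k j) b))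
  (λ (k , w , w′) → from (T-⊗ (A ^ᴹ m) (transpose A ^ᴹ m) i j)
     (k , from (T-^ᴹ⇔Walk A m i k) w , from (T-^ᴹ⇔Walk (transpose A) m k j) (walk-reverse w′)))

T-⇔⇒≡ : ∀ {a b} → T a ⇔ T b → a ≡ b
T-⇔⇒≡ h = ⇔→≡ (⇔.trans (⇔.sym T-≡) (⇔.trans h T-≡))

Least : (ℕ → Set) → Set
Least P = ∃[ q ] (P q × ∀ q′ → P q′ → q ≤ q′)

leastWitness : ∀ {P : ℕ → Set} → Decidable P → ∀ {B} → P B → Least P
leastWitness {P} P? {B} pB = search 0 B (λ _ ()) refl
  where
  search : ∀ k r → (∀ q → q < k → ¬ P q) → k + r ≡ B → Least P
  search k r below k+r≡B with P? k
  ... | yes pk = k , pk , λ q′ pq′ → ≮⇒≥ (λ q′<k → below q′ q′<k pq′)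
  search k zero below k+0≡B | no ¬pk =
    contradiction (subst P (trans (sym k+0≡B) (+-identityʳ k)) pB) ¬pk
  search k (suc r) below k+1+r≡B | no ¬pk =
    search (suc k) r below′ (trans (sym (+-suc k r)) k+1+r≡B)
    where
    below′ : ∀ q → q < suc k → ¬ P q
    below′ q q<1+k with m≤n⇒m<n∨m≡n (s≤s⁻¹ q<1+k)
    ... | inj₁ q<k = below q q<k
    ... | inj₂ refl = ¬pk

module _ {n} (A : Mat n) (M : ℕ) (stable : ∀ m → M ≤ m → compMat A m ≋ compMat A M) where

  ConstantFrom : ℕ → Set
  ConstantFrom q = ∀ k → compMat A (q + k) ≋ compMat A M

  constantFrom? : Decidable ConstantFrom
  constantFrom? q with all? (λ (k : Fin M) → all? λ i → all? λ j →
                          compMat A (q + toℕ k) i j ≟ᴮ compMat A M i j)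
  ... | no ¬below = no λ const → ¬below λ k → const (toℕ k)
  ... | yes below = yes const
    where
    const : ConstantFrom q
    const k with k <? M
    ... | yes k<M =
      subst (λ k → compMat A (q + k) ≋ compMat A M) (toℕ-fromℕ< k<M) (below (fromℕ< k<M))
    ... | no k≮M = stable (q + k) (≤-trans (≮⇒≥ k≮M) (m≤n+m k q))

  compIndexCond⇒constantFrom : ∀ {q} → CompIndexCond A q → ConstantFrom q
  compIndexCond⇒constantFrom {q} (r , r>0 , periodic) k i j =
    trans (iterate M k i j) (stable _ M≤q+Mr+k i j)
    where
    iterate : ∀ l k → compMat A (q + k) ≋ compMat A (q + (l * r + k))
    iterate zero k i j = refl
    iterate (suc l) k i j = trans (iterate l k i j) (trans (periodic (l * r + k) i j)
      (cong (λ e → compMat A e i j) (regroup q r l k)))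
      where
      regroup : ∀ q r l k → q + r + (l * r + k) ≡ q + ((r + l * r) + k)
      regroup = solve-∀
    M≤q+Mr+k : M ≤ q + (M * r + k)
    M≤q+Mr+k = ≤-trans (m≤m*n M r {{>-nonZero r>0}}) (≤-trans (m≤m+n (M * r) k) (m≤n+m _ q))

  constantFrom⇒compIndexCond : ∀ {q} → ConstantFrom q → CompIndexCond A q
  constantFrom⇒compIndexCond {q} const =
    1 , z<s , λ k i j → trans (const k i j) (sym (subst (λ e → compMat A e i j ≡ compMat A M i j)
                                                        (sym (+-assoc q 1 k)) (const (1 + k) i j)))

  -- The competition index is the least q > 0 from which the competition matrices are constant.
  competitionPeriod-1 : CompetitionPeriod A 1
  competitionPeriod-1 = q₀ , index , z<s , period-1 , λ _ p′>0 _ → p′>0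
    where
    least = leastWitness (λ x → constantFrom? (suc x)) {M}
              (λ k → stable (suc M + k) (≤-trans (n≤1+n M) (m≤m+n (suc M) k)))
    q₀ = suc (proj₁ least)
    const₀ : ConstantFrom q₀
    const₀ = proj₁ (proj₂ least)
    index : CompetitionIndex A q₀
    index = z<s , constantFrom⇒compIndexCond {q₀} const₀ ,
      λ { (suc q′) _ cond →
            s≤s (proj₂ (proj₂ least) q′ (compIndexCond⇒constantFrom {suc q′} cond)) }
    period-1 : compMat A q₀ ≋ compMat A (q₀ + 1)
    period-1 i j = begin
      compMat A q₀ i j        ≡⟨ cong (λ e → compMat A e i j) (+-identityʳ q₀) ⟨
      compMat A (q₀ + 0) i j  ≡⟨ const₀ 0 i j ⟩
      compMat A M i j         ≡⟨ const₀ 1 i j ⟨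
      compMat A (q₀ + 1) i j  ∎
      where open ≡-Reasoning

gcd-nonZeroˡ : ∀ m n .{{_ : NonZero m}} → NonZero (gcd m n)
gcd-nonZeroˡ m n = ≢-nonZero (gcd[m,n]≢0 m n (inj₁ (≢-nonZero⁻¹ m)))

module _ (d s : ℕ) .{{_ : NonZero d}} where

  private instance
    gcd-nonZero : NonZero (gcd d s)
    gcd-nonZero = gcd-nonZeroˡ d s

  ∣[/gcd]*  : d ∣ (d / gcd d s) * s
  ∣[/gcd]* = divides (s / gcd d s) (begin
    d / g * s              ≡⟨ cong (d / g *_) (m/n*n≡m (gcd[m,n]∣n d s)) ⟨
    d / g * (s / g * g)    ≡⟨ regroup (d / g) (s / g) g ⟩
    s / g * (d / g * g)    ≡⟨ cong (s / g *_) (m/n*n≡m (gcd[m,n]∣m d s)) ⟩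
    s / g * d              ∎)
    where
    open ≡-Reasoning
    g = gcd d s
    regroup : ∀ a b c → a * (b * c) ≡ b * (a * c)
    regroup = solve-∀

  ∣*⇒[/gcd]∣ : ∀ {p} → d ∣ p * s → d / gcd d s ∣ p
  ∣*⇒[/gcd]∣ {p} d∣ps = coprime-divisor (coprime-/gcd d s)
    (*-cancelʳ-∣ g (subst₂ _∣_ (sym (m/n*n≡m (gcd[m,n]∣m d s))) ps≡ d∣ps))
    where
    g = gcd d s
    ps≡ : p * s ≡ s / g * p * g
    ps≡ = begin
      p * s              ≡⟨ cong (p *_) (m/n*n≡m (gcd[m,n]∣n d s)) ⟨
      p * (s / g * g)    ≡⟨ regroup p (s / g) g ⟩
      s / g * p * g      ∎
      where
      open ≡-Reasoning
      regroup : ∀ a b c → a * (b * c) ≡ b * a * c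
      regroup = solve-∀

module ToeplitzDigraph (n : ℕ) (S T : List⁺ ℕ)
  (1≤s₁ : 1 ≤ minSet S) (1≤t₁ : 1 ≤ minSet T)
  (maxS+minT≤n : maxSet S + minSet T ≤ n)
  (minS+maxT≤n : minSet S + maxSet T ≤ n) where

  A : Mat n
  A = toeplitz n S T

  s₁ t₁ N₀ d : ℕ
  s₁ = minSet S
  t₁ = minSet T
  N₀ = s₁ + t₁
  d = gcdList (sumSet S T)

  s₁∈S : s₁ ∈ toList S
  s₁∈S = minSet-∈ S

  t₁∈T : t₁ ∈ toList T
  t₁∈T = minSet-∈ T

  instance
    N₀-nonZero : NonZero N₀
    N₀-nonZero = >-nonZero (≤-trans 1≤s₁ (m≤m+n s₁ t₁))

  N₀≤n : N₀ ≤ n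
  N₀≤n = ≤-trans (+-monoˡ-≤ t₁ (≤-maxSet S s₁∈S)) maxS+minT≤n

  d∣s+t : ∀ {s t} → s ∈ toList S → t ∈ toList T → d ∣ s + t
  d∣s+t s∈ t∈ = All.lookup (gcdList-∣ (sumSet S T)) (∈-sumSet⁺ s∈ t∈)

  instance
    d-nonZero : NonZero d
    d-nonZero = ≢-nonZero λ d≡0 →
      ≢-nonZero⁻¹ N₀ (0∣⇒≡0 (subst (_∣ N₀) d≡0 (d∣s+t s₁∈S t₁∈T)))

  d≤n : d ≤ n
  d≤n = ≤-trans (∣⇒≤ (d∣s+t s₁∈S t₁∈T)) N₀≤n

  s≡s₁ : ∀ {s} → s ∈ toList S → s ≡ s₁ [mod d ]
  s≡s₁ s∈ = +-cancelʳ-mod t₁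
    (mod-trans (∣⇒≡0-mod (d∣s+t s∈ t₁∈T)) (mod-sym (∣⇒≡0-mod (d∣s+t s₁∈S t₁∈T))))

  t+s₁≡0 : ∀ {t} → t ∈ toList T → t + s₁ ≡ 0 [mod d ]
  t+s₁≡0 {t} t∈ = subst (_≡ 0 [mod d ]) (+-comm s₁ t) (∣⇒≡0-mod (d∣s+t s₁∈S t∈))

  data Arc (x y : ℕ) : Set where
    forward  : ∀ {s} → s ∈ toList S → x + s ≡ y → Arc x y
    backward : ∀ {t} → t ∈ toList T → y + t ≡ x → Arc x y

  T-A⇔Arc : ∀ i j → Bool.T (A i j) ⇔ Arc (toℕ i) (toℕ j)
  T-A⇔Arc i j = mk⇔ arc entry
    where
    x = toℕ i
    y = toℕ j
    jumpˢ jumpᵗ : ℕ → Bool.Bool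
    jumpˢ s = (x + s) ≡ᵇ y
    jumpᵗ t = (y + t) ≡ᵇ x
    T-A⇔ : Bool.T (A i j) ⇔ (Bool.T (any jumpˢ (toList S)) ⊎ Bool.T (any jumpᵗ (toList T)))
    T-A⇔ = T-∨
    arc : Bool.T (A i j) → Arc x y
    arc h with to T-A⇔ h
    ... | inj₁ h′ = let _ , s∈ , eq = to (T-any⇔∃∈ jumpˢ (toList S)) h′
                    in forward s∈ (≡ᵇ⇒≡ (x + _) y eq)
    ... | inj₂ h′ = let _ , t∈ , eq = to (T-any⇔∃∈ jumpᵗ (toList T)) h′
                    in backward t∈ (≡ᵇ⇒≡ (y + _) x eq)
    entry : Arc x y → Bool.T (A i j)
    entry (forward s∈ eq) =
      from T-A⇔ (inj₁ (from (T-any⇔∃∈ jumpˢ (toList S)) (_ , s∈ , ≡⇒≡ᵇ (x + _) y eq)))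
    entry (backward t∈ eq) =
      from T-A⇔ (inj₂ (from (T-any⇔∃∈ jumpᵗ (toList T)) (_ , t∈ , ≡⇒≡ᵇ (y + _) x eq)))

  arc-≡-mod : ∀ {x y} → Arc x y → y ≡ x + s₁ [mod d ]
  arc-≡-mod {x} (forward s∈ refl) = +-congˡ-mod x (s≡s₁ s∈)
  arc-≡-mod {y = y} (backward {t} t∈ refl) = begin
    y             ≡⟨ +-identityʳ y ⟨
    y + 0         ≈⟨ +-congˡ-mod y (t+s₁≡0 t∈) ⟨
    y + (t + s₁)  ≡⟨ +-assoc y t s₁ ⟨
    y + t + s₁    ∎
    where open ≡-mod-Reasoning d

  walk-≡-mod : ∀ {m i j} → Walk A m i j → toℕ j ≡ toℕ i + m * s₁ [mod d ]
  walk-≡-mod stop = mod-reflexive (sym (+-identityʳ _))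
  walk-≡-mod {suc m} {i} {j} (step {x = k} a w) = begin
    toℕ j                ≈⟨ walk-≡-mod w ⟩
    toℕ k + m * s₁       ≈⟨ +-congʳ-mod (m * s₁) (arc-≡-mod (to (T-A⇔Arc i k) a)) ⟩
    toℕ i + s₁ + m * s₁  ≡⟨ +-assoc (toℕ i) s₁ (m * s₁) ⟩
    toℕ i + suc m * s₁   ∎
    where open ≡-mod-Reasoning d

  data Path : ℕ → ℕ → ℕ → Set where
    []   : ∀ {x} → Path 0 x x
    move : ∀ {m x y z} → y < n → Arc x y → Path m y z → Path (suc m) x z

  _++ᴾ_ : ∀ {k m x y z} → Path k x y → Path m y z → Path (k + m) x z
  [] ++ᴾ q = q
  move y<n a p ++ᴾ q = move y<n a (p ++ᴾ q)

  path⇒walk : ∀ {m x z} (i j : Fin n) → toℕ i ≡ x → toℕ j ≡ z → Path m x z → Walk A m i j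
  path⇒walk i j i≡x j≡z [] = subst (Walk A 0 i) (toℕ-injective (trans i≡x (sym j≡z))) stop
  path⇒walk i j refl j≡z (move y<n a p) =
    step (from (T-A⇔Arc i k) (subst (Arc _) (sym (toℕ-fromℕ< y<n)) a))
         (path⇒walk k j (toℕ-fromℕ< y<n) j≡z p)
    where k = fromℕ< y<n

  +-*-suc : ∀ y k t → y + suc k * t ≡ y + k * t + t
  +-*-suc y k t = trans (cong (y +_) (+-comm t (k * t))) (sym (+-assoc y (k * t) t))

  x<x+N₀ : ∀ x → x < x + N₀
  x<x+N₀ x = m<m+n x (>-nonZero⁻¹ N₀)

  +-suc-≤-+s₁ : ∀ x ℓ → x + suc ℓ ≤ x + s₁ + ℓ
  +-suc-≤-+s₁ x ℓ = begin
    x + suc ℓ   ≡⟨ +-suc x ℓ ⟩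
    suc x + ℓ   ≤⟨ +-monoˡ-≤ ℓ (subst (_≤ x + s₁) (+-comm x 1) (+-monoʳ-≤ x 1≤s₁)) ⟩
    x + s₁ + ℓ  ∎
    where open ≤-Reasoning

  +t₁≡⇒≡+s₁ : ∀ {z p} → z + t₁ ≡ p [mod N₀ ] → z ≡ p + s₁ [mod N₀ ]
  +t₁≡⇒≡+s₁ {z} {p} z+t₁≡p = begin
    z              ≈⟨ +-modulus-mod z ⟨
    z + N₀         ≡⟨ cong (z +_) (+-comm s₁ t₁) ⟩
    z + (t₁ + s₁)  ≡⟨ +-assoc z t₁ s₁ ⟨
    z + t₁ + s₁    ≈⟨ +-congʳ-mod s₁ z+t₁≡p ⟩
    p + s₁         ∎
    where open ≡-mod-Reasoning N₀

  +s₁+t₁-mod : ∀ x → x + s₁ + t₁ ≡ x [mod N₀ ]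
  +s₁+t₁-mod x = mod-trans (mod-reflexive (+-assoc x s₁ t₁)) (+-modulus-mod x)

  -- Modulo N₀ both kinds of step used below, +s₁ and -t₁, move a vertex by -t₁.
  step-≡-mod : ∀ {y k x′ x} → y + k * t₁ ≡ x′ [mod N₀ ] → x′ + t₁ ≡ x [mod N₀ ] →
               y + suc k * t₁ ≡ x [mod N₀ ]
  step-≡-mod {y} {k} y≡x′ x′+t₁≡x =
    mod-trans (mod-reflexive (+-*-suc y k t₁)) (mod-trans (+-congʳ-mod t₁ y≡x′) x′+t₁≡x)

  -- Step by +s₁ when that stays below c + N₀, by -t₁ otherwise.
  bounce-in-window : ∀ k {c x} → c + N₀ ≤ n → c ≤ x → x < c + N₀ →
                     ∃ λ y → c ≤ y × y < c + N₀ × Path k x y × y + k * t₁ ≡ x [mod N₀ ]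
  bounce-in-window zero _ c≤x x<c+N₀ = _ , c≤x , x<c+N₀ , [] , mod-reflexive (+-identityʳ _)
  bounce-in-window (suc k) {c} {x} c+N₀≤n c≤x x<c+N₀ with x + s₁ <? c + N₀
  ... | yes x+s₁<c+N₀ =
    let y , c≤y , y<c+N₀ , p , y≡ =
          bounce-in-window k c+N₀≤n (≤-trans c≤x (m≤m+n x s₁)) x+s₁<c+N₀
    in y , c≤y , y<c+N₀ , move (<-≤-trans x+s₁<c+N₀ c+N₀≤n) (forward s₁∈S refl) p ,
       step-≡-mod {y} {k} y≡ (+s₁+t₁-mod x)
  ... | no x+s₁≮c+N₀ =
    let y , c≤y , y<c+N₀ , p , y≡ =
          bounce-in-window k c+N₀≤n (m+n≤o⇒m≤o∸n c c+t₁≤x) x∸t₁<c+N₀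
    in y , c≤y , y<c+N₀ ,
       move (<-≤-trans x∸t₁<c+N₀ c+N₀≤n) (backward t₁∈T (m∸n+n≡m t₁≤x)) p ,
       step-≡-mod {y} {k} y≡ (mod-reflexive (m∸n+n≡m t₁≤x))
    where
    c+t₁≤x : c + t₁ ≤ x
    c+t₁≤x = +-cancelʳ-≤ s₁ (c + t₁) x (begin
      c + t₁ + s₁    ≡⟨ +-assoc c t₁ s₁ ⟩
      c + (t₁ + s₁)  ≡⟨ cong (c +_) (+-comm t₁ s₁) ⟩
      c + N₀         ≤⟨ ≮⇒≥ x+s₁≮c+N₀ ⟩
      x + s₁         ∎)
      where open ≤-Reasoning
    t₁≤x : t₁ ≤ x
    t₁≤x = ≤-trans (m≤n+m t₁ c) c+t₁≤x
    x∸t₁<c+N₀ : x ∸ t₁ < c + N₀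
    x∸t₁<c+N₀ = ≤-<-trans (m∸n≤m x t₁) x<c+N₀

  path-in-window : ∀ ℓ {c p v} → c + N₀ ≤ n → c ≤ p → p < c + N₀ → c ≤ v → v < c + N₀ →
                   v + ℓ * t₁ ≡ p [mod N₀ ] → Path ℓ p v
  path-in-window ℓ c+N₀≤n c≤p p<c+N₀ c≤v v<c+N₀ v≡ =
    let y , c≤y , y<c+N₀ , path , y≡ = bounce-in-window ℓ c+N₀≤n c≤p p<c+N₀
    in subst (Path ℓ _) (≡-mod-unique-in-window c≤y y<c+N₀ c≤v v<c+N₀
                          (+-cancelʳ-mod (ℓ * t₁) (mod-trans y≡ (mod-sym v≡)))) path

  -- Far apart, step towards the target; close together, both ends lie in a common window.
  zigzag : ∀ ℓ {p v} → p < n → v < n → v ≤ p + ℓ → p ≤ v + ℓ →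
           v + ℓ * t₁ ≡ p [mod N₀ ] → Path ℓ p v
  zigzag ℓ {p} {v} p<n v<n v≤p+ℓ p≤v+ℓ v≡ with p + N₀ ≤? v | v + N₀ ≤? p
  zigzag zero {p} {v} _ _ v≤p+0 _ _ | yes p+N₀≤v | _ =
    contradiction (≤-trans p+N₀≤v (subst (v ≤_) (+-identityʳ p) v≤p+0)) (<⇒≱ (x<x+N₀ p))
  zigzag (suc ℓ) {p} {v} p<n v<n v≤p+ℓ p≤v+ℓ v≡ | yes p+N₀≤v | _ =
    move p+s₁<n (forward s₁∈S refl)
      (zigzag ℓ p+s₁<n v<n (≤-trans v≤p+ℓ (+-suc-≤-+s₁ p ℓ)) (≤-trans p+s₁≤v (m≤m+n v ℓ))
        (+t₁≡⇒≡+s₁ (mod-trans (mod-reflexive (sym (+-*-suc v ℓ t₁))) v≡)))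
    where
    p+s₁≤v : p + s₁ ≤ v
    p+s₁≤v = ≤-trans (+-monoʳ-≤ p (m≤m+n s₁ t₁)) p+N₀≤v
    p+s₁<n : p + s₁ < n
    p+s₁<n = ≤-<-trans p+s₁≤v v<n
  zigzag zero {p} {v} _ _ _ p≤v+0 _ | no _ | yes v+N₀≤p =
    contradiction (≤-trans v+N₀≤p (subst (p ≤_) (+-identityʳ v) p≤v+0)) (<⇒≱ (x<x+N₀ v))
  zigzag (suc ℓ) {p} {v} p<n v<n v≤p+ℓ p≤v+ℓ v≡ | no _ | yes v+N₀≤p =
    move p∸t₁<n (backward t₁∈T (m∸n+n≡m t₁≤p))
      (zigzag ℓ p∸t₁<n v<n (≤-trans v≤p∸t₁ (m≤m+n _ ℓ))
        (≤-trans (∸-monoʳ-≤ p 1≤t₁)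
                 (subst (p ∸ 1 ≤_) (cong (_∸ 1) (+-suc v ℓ)) (∸-monoˡ-≤ 1 p≤v+ℓ)))
        (+-cancelʳ-mod t₁ (mod-trans (mod-reflexive (sym (+-*-suc v ℓ t₁)))
                             (mod-trans v≡ (mod-reflexive (sym (m∸n+n≡m t₁≤p)))))))
    where
    v+t₁≤p : v + t₁ ≤ p
    v+t₁≤p = ≤-trans (+-monoʳ-≤ v (m≤n+m t₁ s₁)) v+N₀≤p
    t₁≤p : t₁ ≤ p
    t₁≤p = ≤-trans (m≤n+m t₁ v) v+t₁≤p
    v≤p∸t₁ : v ≤ p ∸ t₁
    v≤p∸t₁ = m+n≤o⇒m≤o∸n v v+t₁≤p
    p∸t₁<n : p ∸ t₁ < n
    p∸t₁<n = ≤-<-trans (m∸n≤m p t₁) p<n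
  zigzag ℓ {p} {v} p<n v<n _ _ v≡ | no p+N₀≰v | no v+N₀≰p =
    path-in-window ℓ c+N₀≤n
      (≤-trans (m⊓n≤m _ _) (m⊓n≤m p v)) (below-c+N₀ (x<x+N₀ p) (≰⇒> v+N₀≰p) p<n)
      (≤-trans (m⊓n≤m _ _) (m⊓n≤n p v)) (below-c+N₀ (≰⇒> p+N₀≰v) (x<x+N₀ v) v<n) v≡
    where
    c = p ⊓ v ⊓ (n ∸ N₀)
    c+N₀≤n : c + N₀ ≤ n
    c+N₀≤n = ≤-trans (+-monoˡ-≤ N₀ (m⊓n≤n (p ⊓ v) (n ∸ N₀))) (≤-reflexive (m∸n+n≡m N₀≤n))
    c+N₀≡ : c + N₀ ≡ (p + N₀) ⊓ (v + N₀) ⊓ n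
    c+N₀≡ = trans (+-distribʳ-⊓ N₀ (p ⊓ v) (n ∸ N₀))
                  (cong₂ _⊓_ (+-distribʳ-⊓ N₀ p v) (m∸n+n≡m N₀≤n))
    below-c+N₀ : ∀ {x} → x < p + N₀ → x < v + N₀ → x < n → x < c + N₀
    below-c+N₀ x<p+N₀ x<v+N₀ x<n = subst (_ <_) (sym c+N₀≡) (⊓-glb (⊓-glb x<p+N₀ x<v+N₀) x<n)

  descend : ∀ f {x} → x ≤ f → x < n →
            ∃₂ λ y τ → y < t₁ × τ ≤ f × Path τ x y × y + τ * t₁ ≡ x
  descend f {x} x≤f x<n with x <? t₁
  ... | yes x<t₁ = x , 0 , x<t₁ , z≤n , [] , +-identityʳ x
  descend zero {x} x≤0 x<n | no x≮t₁ = contradiction (≤-trans (s≤s x≤0) 1≤t₁) x≮t₁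
  descend (suc f) {x} x≤1+f x<n | no x≮t₁ =
    let y , τ , y<t₁ , τ≤f , p , y+τt₁≡x∸t₁ =
          descend f (≤-trans (∸-monoʳ-≤ x 1≤t₁) (∸-monoˡ-≤ 1 x≤1+f)) x∸t₁<n
    in y , suc τ , y<t₁ , s≤s τ≤f , move x∸t₁<n (backward t₁∈T (m∸n+n≡m t₁≤x)) p ,
       trans (+-*-suc y τ t₁) (trans (cong (_+ t₁) y+τt₁≡x∸t₁) (m∸n+n≡m t₁≤x))
    where
    t₁≤x : t₁ ≤ x
    t₁≤x = ≮⇒≥ x≮t₁
    x∸t₁<n : x ∸ t₁ < n
    x∸t₁<n = ≤-<-trans (m∸n≤m x t₁) x<n

  ascend : ∀ f {x} → n ≤ x + f → x < n →
           ∃₂ λ y τ → y < n × n ≤ y + s₁ × τ ≤ f × Path τ x y × y ≡ x + τ * s₁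
  ascend f {x} _ x<n with n ≤? x + s₁
  ... | yes n≤x+s₁ = x , 0 , x<n , n≤x+s₁ , z≤n , [] , sym (+-identityʳ x)
  ascend zero {x} n≤x+0 x<n | no _ = contradiction (subst (n ≤_) (+-identityʳ x) n≤x+0) (<⇒≱ x<n)
  ascend (suc f) {x} n≤x+1+f x<n | no n≰x+s₁ =
    let y , τ , y<n , n≤y+s₁ , τ≤f , p , y≡ =
          ascend f (≤-trans n≤x+1+f (+-suc-≤-+s₁ x f)) (≰⇒> n≰x+s₁)
    in y , suc τ , y<n , n≤y+s₁ , s≤s τ≤f , move (≰⇒> n≰x+s₁) (forward s₁∈S refl) p ,
       trans y≡ (+-assoc x s₁ (τ * s₁))

  -- Measured against the drift of -t₁ per step that zigzag paths have, a Shift δ B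
  -- path moves the N₀-class of every start by δ, in at most B steps.
  Shift : ℕ → ℕ → Set
  Shift δ B = ∀ {x} → x < n →
    ∃₂ λ y τ → y < n × τ ≤ B × Path τ x y × y + τ * t₁ ≡ x + δ [mod N₀ ]

  shift-0 : Shift 0 0
  shift-0 x<n = _ , 0 , x<n , z≤n , [] , mod-refl

  shift-+ : ∀ {a b Bₐ Bᵦ} → Shift a Bₐ → Shift b Bᵦ → Shift (a + b) (Bₐ + Bᵦ)
  shift-+ {a} {b} shift-a shift-b {x} x<n =
    let y₁ , τ₁ , y₁<n , τ₁≤ , p₁ , y₁≡ = shift-a x<n
        y₂ , τ₂ , y₂<n , τ₂≤ , p₂ , y₂≡ = shift-b y₁<n
    in y₂ , τ₁ + τ₂ , y₂<n , +-mono-≤ τ₁≤ τ₂≤ , p₁ ++ᴾ p₂ , (begin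
      y₂ + (τ₁ + τ₂) * t₁        ≡⟨ regroup y₂ τ₁ τ₂ t₁ ⟩
      y₂ + τ₂ * t₁ + τ₁ * t₁     ≈⟨ +-congʳ-mod (τ₁ * t₁) y₂≡ ⟩
      y₁ + b + τ₁ * t₁           ≡⟨ swap y₁ b (τ₁ * t₁) ⟩
      y₁ + τ₁ * t₁ + b           ≈⟨ +-congʳ-mod b y₁≡ ⟩
      x + a + b                  ≡⟨ +-assoc x a b ⟩
      x + (a + b)                ∎)
    where
    open ≡-mod-Reasoning N₀
    regroup : ∀ y k l t → y + (k + l) * t ≡ y + l * t + k * t
    regroup = solve-∀
    swap : ∀ y u w → y + u + w ≡ y + w + u
    swap = solve-∀

  shift-resp : ∀ {a b B} → a ≡ b [mod N₀ ] → Shift a B → Shift b B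
  shift-resp a≡b shift-a x<n =
    let y , τ , y<n , τ≤ , p , y≡ = shift-a x<n
    in y , τ , y<n , τ≤ , p , mod-trans y≡ (+-congˡ-mod _ a≡b)

  shift-* : ∀ k {a B} → Shift a B → Shift (k * a) (k * B)
  shift-* zero _ = shift-0
  shift-* (suc k) shift-a = shift-+ shift-a (shift-* k shift-a)

  -- Descend by t₁ to below t₁, then jump forward by s.
  shift-s+t₁ : ∀ {s} → s ∈ toList S → Shift (s + t₁) (n + 1)
  shift-s+t₁ {s} s∈ {x} x<n =
    let y , τ , y<t₁ , τ≤n , p , y+τt₁≡x = descend n (<⇒≤ x<n) x<n
        y+s<n = <-≤-trans (+-monoˡ-< s y<t₁) (≤-trans (+-monoʳ-≤ t₁ (≤-maxSet S s∈))
                  (subst (_≤ n) (+-comm (maxSet S) t₁) maxS+minT≤n))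
    in y + s , τ + 1 , y+s<n , +-monoˡ-≤ 1 τ≤n , p ++ᴾ move y+s<n (forward s∈ refl) [] ,
       mod-reflexive (trans (regroup y s τ t₁) (cong (_+ (s + t₁)) y+τt₁≡x))
    where
    regroup : ∀ y s k t → y + s + (k + 1) * t ≡ y + k * t + (s + t)
    regroup = solve-∀

  -- Ascend by s₁ to within s₁ of the top, then jump back by t.
  shift-−[s₁+t] : ∀ {t} → t ∈ toList T → Shift (pred N₀ * (s₁ + t)) (n + 1)
  shift-−[s₁+t] {t} t∈ {x} x<n =
    let y , τ , y<n , n≤y+s₁ , τ≤n , p , y≡x+τs₁ = ascend n (m≤n+m n x) x<n
        t≤y = +-cancelʳ-≤ s₁ t y (subst (_≤ y + s₁) (+-comm s₁ t)
                (≤-trans (+-monoʳ-≤ s₁ (≤-maxSet T t∈)) (≤-trans minS+maxT≤n n≤y+s₁)))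
        y∸t<n = ≤-<-trans (m∸n≤m y t) y<n
    in y ∸ t , τ + 1 , y∸t<n , +-monoˡ-≤ 1 τ≤n ,
       p ++ᴾ move y∸t<n (backward t∈ (m∸n+n≡m t≤y)) [] ,
       −-as-+-mod (begin
         y ∸ t + (τ + 1) * t₁ + (s₁ + t)   ≡⟨ regroup₁ (y ∸ t) t τ s₁ t₁ ⟩
         y ∸ t + t + ((τ + 1) * t₁ + s₁)   ≡⟨ cong (_+ ((τ + 1) * t₁ + s₁)) (m∸n+n≡m t≤y) ⟩
         y + ((τ + 1) * t₁ + s₁)           ≡⟨ cong (_+ ((τ + 1) * t₁ + s₁)) y≡x+τs₁ ⟩
         x + τ * s₁ + ((τ + 1) * t₁ + s₁)  ≡⟨ regroup₂ x τ s₁ t₁ ⟩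
         x + (τ + 1) * N₀                  ≈⟨ +-multiple-mod x (τ + 1) ⟩
         x                                 ∎)
    where
    open ≡-mod-Reasoning N₀
    regroup₁ : ∀ y t k s u → y + (k + 1) * u + (s + t) ≡ y + t + ((k + 1) * u + s)
    regroup₁ = solve-∀
    regroup₂ : ∀ x k s u → x + k * s + ((k + 1) * u + s) ≡ x + (k + 1) * (s + u)
    regroup₂ = solve-∀

  Shiftable : ℕ → Set
  Shiftable δ = ∃ (Shift δ)

  shiftable-+ : ∀ {a b} → Shiftable a → Shiftable b → Shiftable (a + b)
  shiftable-+ (Bₐ , shift-a) (Bᵦ , shift-b) = Bₐ + Bᵦ , shift-+ shift-a shift-b

  shiftable-resp : ∀ {a b} → a ≡ b [mod N₀ ] → Shiftable a → Shiftable b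
  shiftable-resp a≡b (B , shift-a) = B , shift-resp a≡b shift-a

  open GcdClosed Shiftable (0 , shift-0) shiftable-+ shiftable-resp

  shiftable-s+t : ∀ {s t} → s ∈ toList S → t ∈ toList T → Shiftable (s + t)
  shiftable-s+t {s} {t} s∈ t∈ =
    shiftable-resp s+t₁+[s₁+t]≡s+t
      (shiftable-+ (_ , shift-s+t₁ s∈) (P-neg (+-pred*-≡0-mod (s₁ + t)) (_ , shift-−[s₁+t] t∈)))
    where
    s+t₁+[s₁+t]≡s+t : s + t₁ + (s₁ + t) ≡ s + t [mod N₀ ]
    s+t₁+[s₁+t]≡s+t = mod-trans (mod-reflexive (regroup s t s₁ t₁)) (+-modulus-mod (s + t))
      where
      regroup : ∀ s t a b → s + b + (a + t) ≡ s + t + (a + b)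
      regroup = solve-∀

  shiftable-d : Shiftable d
  shiftable-d = P-gcdList (All.tabulate λ v∈ →
    let s , t , s∈ , t∈ , v≡s+t = ∈-sumSet⁻ v∈ in subst Shiftable (sym v≡s+t) (shiftable-s+t s∈ t∈))

  -- From v + a d = u + m s₁ + b d and s₁ + t₁ = N₀ we get v + m t₁ ≡ u + (b - a) d (mod N₀).
  ≡-mod-d⇒≡-mod-N₀ : ∀ {u v m} → v ≡ u + m * s₁ [mod d ] →
                      ∃ λ c → c < N₀ × v + m * t₁ ≡ u + c * d [mod N₀ ]
  ≡-mod-d⇒≡-mod-N₀ {u} {v} {m} (a , b , v+ad≡) = C % N₀ , m%n<n C N₀ , (begin
    v + m * t₁                          ≈⟨ −-as-+-mod (0 , m , move-multiples) ⟩
    u + b * d + pred N₀ * (a * d)       ≡⟨ regroup₂ u b d (pred N₀) a ⟩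
    u + C * d                           ≈⟨ +-congˡ-mod u (*-congʳ-mod d (%-mod C N₀)) ⟨
    u + C % N₀ * d                      ∎)
    where
    open ≡-mod-Reasoning N₀
    C = b + pred N₀ * a
    regroup₁ : ∀ v w a d m t → v + m * t + a * d + 0 * w ≡ v + a * d + m * t
    regroup₁ = solve-∀
    regroup₂ : ∀ u b d k a → u + b * d + k * (a * d) ≡ u + (b + k * a) * d
    regroup₂ = solve-∀
    regroup₃ : ∀ u m s b d t → u + m * s + b * d + m * t ≡ u + b * d + m * (s + t)
    regroup₃ = solve-∀
    move-multiples : v + m * t₁ + a * d + 0 * N₀ ≡ u + b * d + m * N₀
    move-multiples = trans (regroup₁ v N₀ a d m t₁)
                    (trans (cong (_+ m * t₁) v+ad≡) (regroup₃ u m s₁ b d t₁))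

  B-d : ℕ
  B-d = proj₁ shiftable-d

  shift-d : Shift d B-d
  shift-d = proj₂ shiftable-d

  M : ℕ
  M = N₀ * B-d + n

  path-by-zigzag : ∀ {m τ u y v} → τ + n ≤ m → y < n → v < n → Path τ u y →
                   v + (m ∸ τ) * t₁ ≡ y [mod N₀ ] → Path m u v
  path-by-zigzag {m} {τ} {u} {y} {v} τ+n≤m y<n v<n p v≡ =
    subst (λ k → Path k u v) (m+[n∸m]≡n τ≤m)
      (p ++ᴾ zigzag (m ∸ τ) y<n v<n (≤-trans (<⇒≤ v<n) (≤-trans n≤m∸τ (m≤n+m _ y)))
                                    (≤-trans (<⇒≤ y<n) (≤-trans n≤m∸τ (m≤n+m _ v))) v≡)
    where
    τ≤m : τ ≤ m
    τ≤m = ≤-trans (m≤m+n τ n) τ+n≤m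
    n≤m∸τ : n ≤ m ∸ τ
    n≤m∸τ = m+n≤o⇒m≤o∸n n (subst (_≤ m) (+-comm τ n) τ+n≤m)

  ≡-mod-after-shift : ∀ {m τ v y w} → τ ≤ m →
                      v + m * t₁ ≡ w [mod N₀ ] → y + τ * t₁ ≡ w [mod N₀ ] →
                      v + (m ∸ τ) * t₁ ≡ y [mod N₀ ]
  ≡-mod-after-shift {m} {τ} {v} {y} {w} τ≤m v≡w y≡w = +-cancelʳ-mod (τ * t₁) (begin
    v + (m ∸ τ) * t₁ + τ * t₁  ≡⟨ regroup v (m ∸ τ) τ t₁ ⟩
    v + (τ + (m ∸ τ)) * t₁     ≡⟨ cong (λ k → v + k * t₁) (m+[n∸m]≡n τ≤m) ⟩
    v + m * t₁                 ≈⟨ v≡w ⟩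
    w                          ≈⟨ y≡w ⟨
    y + τ * t₁                 ∎)
    where
    open ≡-mod-Reasoning N₀
    regroup : ∀ v l k t → v + l * t + k * t ≡ v + (k + l) * t
    regroup = solve-∀

  -- First move the N₀-class into place, then zigzag for the remaining ≥ n steps.
  path-of-length : ∀ {m u v} → M ≤ m → u < n → v < n → v ≡ u + m * s₁ [mod d ] → Path m u v
  path-of-length {m} {u} {v} M≤m u<n v<n v≡ =
    let c , c<N₀ , v+mt₁≡ = ≡-mod-d⇒≡-mod-N₀ {u} {v} {m} v≡
        y , τ , y<n , τ≤cB , p , y+τt₁≡ = shift-* c shift-d u<n
        τ+n≤m = ≤-trans (+-monoˡ-≤ n (≤-trans τ≤cB (*-monoˡ-≤ B-d (<⇒≤ c<N₀)))) M≤m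
    in path-by-zigzag τ+n≤m y<n v<n p
         (≡-mod-after-shift (≤-trans (m≤m+n τ n) τ+n≤m) v+mt₁≡ y+τt₁≡)

  walk-of-length : ∀ {m} (i j : Fin n) → M ≤ m → toℕ j ≡ toℕ i + m * s₁ [mod d ] → Walk A m i j
  walk-of-length i j M≤m j≡ = path⇒walk i j refl refl (path-of-length M≤m (toℕ<n i) (toℕ<n j) j≡)

  vertex-in-class : ∀ x → ∃ λ (k : Fin n) → toℕ k ≡ x [mod d ]
  vertex-in-class x = fromℕ< x%d<n , subst (_≡ x [mod d ]) (sym (toℕ-fromℕ< x%d<n)) (%-mod x d)
    where
    x%d<n : x % d < n
    x%d<n = <-≤-trans (m%n<n x d) d≤n

  T-^ᴹ⇔≡-mod : ∀ {m} (i j : Fin n) → M ≤ m →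
               Bool.T ((A ^ᴹ m) i j) ⇔ toℕ j ≡ toℕ i + m * s₁ [mod d ]
  T-^ᴹ⇔≡-mod {m} i j M≤m = mk⇔ (λ h → walk-≡-mod (to (T-^ᴹ⇔Walk A m i j) h))
                               (λ j≡ → from (T-^ᴹ⇔Walk A m i j) (walk-of-length i j M≤m j≡))

  commonEnd⇔≡-mod : ∀ {m} (i j : Fin n) → M ≤ m →
                    (∃ λ k → Walk A m i k × Walk A m j k) ⇔ toℕ i ≡ toℕ j [mod d ]
  commonEnd⇔≡-mod {m} i j M≤m = mk⇔ same-class common-end
    where
    same-class : (∃ λ k → Walk A m i k × Walk A m j k) → toℕ i ≡ toℕ j [mod d ]
    same-class (k , w , w′) =
      +-cancelʳ-mod (m * s₁) (mod-trans (mod-sym (walk-≡-mod w)) (walk-≡-mod w′))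
    common-end : toℕ i ≡ toℕ j [mod d ] → ∃ λ k → Walk A m i k × Walk A m j k
    common-end i≡j =
      let k , k≡ = vertex-in-class (toℕ i + m * s₁)
      in k , walk-of-length i k M≤m k≡ ,
             walk-of-length j k M≤m (mod-trans k≡ (+-congʳ-mod (m * s₁) i≡j))

  d′ : ℕ
  d′ = gcd d s₁

  instance
    d′-nonZero : NonZero d′
    d′-nonZero = gcd-nonZeroˡ d s₁

  p : ℕ
  p = d / d′

  p*d′≡d : p * d′ ≡ d
  p*d′≡d = m/n*n≡m (gcd[m,n]∣m d s₁)

  p>0 : 0 < p
  p>0 = n≢0⇒n>0 λ p≡0 → ≢-nonZero⁻¹ d (trans (sym p*d′≡d) (cong (_* d′) p≡0))

  +[m+p]*s₁≡+m*s₁ : ∀ x m → x + (m + p) * s₁ ≡ x + m * s₁ [mod d ]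
  +[m+p]*s₁≡+m*s₁ x m = begin
    x + (m + p) * s₁        ≡⟨ cong (x +_) (*-distribʳ-+ s₁ m p) ⟩
    x + (m * s₁ + p * s₁)   ≈⟨ +-congˡ-mod x (+-congˡ-mod (m * s₁) ps₁≡0) ⟩
    x + (m * s₁ + 0)        ≡⟨ cong (x +_) (+-identityʳ (m * s₁)) ⟩
    x + m * s₁              ∎
    where
    open ≡-mod-Reasoning d
    ps₁≡0 : p * s₁ ≡ 0 [mod d ]
    ps₁≡0 = ∣⇒≡0-mod (∣[/gcd]* d s₁)

  eventuallyPeriodic-p : EventuallyPeriodic A p
  eventuallyPeriodic-p = M , λ m M≤m i j → T-⇔⇒≡ (⇔.trans (T-^ᴹ⇔≡-mod i j M≤m)
    (⇔.trans (+p-invariant m i j) (⇔.sym (T-^ᴹ⇔≡-mod i j (≤-trans M≤m (m≤m+n m p))))))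
    where
    +p-invariant : ∀ m (i j : Fin n) →
                   toℕ j ≡ toℕ i + m * s₁ [mod d ] ⇔ toℕ j ≡ toℕ i + (m + p) * s₁ [mod d ]
    +p-invariant m i j = mk⇔ (λ j≡ → mod-trans j≡ (mod-sym (+[m+p]*s₁≡+m*s₁ (toℕ i) m)))
                             (λ j≡ → mod-trans j≡ (+[m+p]*s₁≡+m*s₁ (toℕ i) m))

  -- Periodicity with period p′ at a single entry already forces d ∣ p′ s₁.
  p-minimal : ∀ p′ → 0 < p′ → EventuallyPeriodic A p′ → p ≤ p′
  p-minimal p′ p′>0 (M′ , periodic) =
    ∣⇒≤ {{>-nonZero p′>0}} (∣*⇒[/gcd]∣ d s₁ (≡0-mod⇒∣ p′s₁≡0))
    where
    m = M + M′
    i = proj₁ (vertex-in-class 0)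
    j = proj₁ (vertex-in-class (toℕ i + m * s₁))
    j≡ : toℕ j ≡ toℕ i + m * s₁ [mod d ]
    j≡ = proj₂ (vertex-in-class (toℕ i + m * s₁))
    entry : Bool.T ((A ^ᴹ (m + p′)) i j)
    entry = subst Bool.T (periodic m (m≤n+m M′ M) i j) (from (T-^ᴹ⇔≡-mod i j (m≤m+n M M′)) j≡)
    j≡′ : toℕ j ≡ toℕ i + (m + p′) * s₁ [mod d ]
    j≡′ = to (T-^ᴹ⇔≡-mod i j (≤-trans (m≤m+n M M′) (m≤m+n m p′))) entry
    p′s₁≡0 : p′ * s₁ ≡ 0 [mod d ]
    p′s₁≡0 = +-cancelˡ-mod (toℕ i + m * s₁) (begin
      toℕ i + m * s₁ + p′ * s₁    ≡⟨ +-assoc (toℕ i) (m * s₁) (p′ * s₁) ⟩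
      toℕ i + (m * s₁ + p′ * s₁)  ≡⟨ cong (toℕ i +_) (*-distribʳ-+ s₁ m p′) ⟨
      toℕ i + (m + p′) * s₁       ≈⟨ j≡′ ⟨
      toℕ j                       ≈⟨ j≡ ⟩
      toℕ i + m * s₁              ≡⟨ +-identityʳ _ ⟨
      toℕ i + m * s₁ + 0          ∎)
      where open ≡-mod-Reasoning d

  matrixPeriod : ∃[ q ] (MatrixPeriod A q × q * d′ ≡ d)
  matrixPeriod = p , (p>0 , eventuallyPeriodic-p , p-minimal) , p*d′≡d

  T-compMat⇔≡-mod : ∀ {m} (i j : Fin n) → M ≤ m →
                    Bool.T (compMat A m i j) ⇔ toℕ i ≡ toℕ j [mod d ]
  T-compMat⇔≡-mod {m} i j M≤m = ⇔.trans (T-compMat⇔commonEnd A m i j) (commonEnd⇔≡-mod i j M≤m)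

  compMat-stable : ∀ m → M ≤ m → compMat A m ≋ compMat A M
  compMat-stable m M≤m i j =
    T-⇔⇒≡ (⇔.trans (T-compMat⇔≡-mod i j M≤m) (⇔.sym (T-compMat⇔≡-mod i j ≤-refl)))

  CompAdj⇔≡-mod : ∀ {m} (u v : Fin n) → M ≤ m →
                  CompAdj A m u v ⇔ (¬ (u ≡ v) × toℕ u ≡ toℕ v [mod d ])
  CompAdj⇔≡-mod u v M≤m = ⇔.refl ×-⇔ commonEnd⇔≡-mod u v M≤m

  competitionPeriod : CompetitionPeriod A 1
  competitionPeriod = competitionPeriod-1 A M compMat-stable

  competitionGraph-stable : ∃[ M ] (∀ m → M ≤ m → (u v : Fin n) → CompAdj A m u v ⇔ CompAdj A M u v)
  competitionGraph-stable = M , λ m M≤m u v →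
    ⇔.trans (CompAdj⇔≡-mod u v M≤m) (⇔.sym (CompAdj⇔≡-mod u v ≤-refl))

  competitionGraph-classes : ∃[ M ] (∀ m → M ≤ m → (u v : Fin n) →
                               CompAdj A m u v ⇔ (¬ (u ≡ v) × d ∣ ∣ toℕ u - toℕ v ∣))
  competitionGraph-classes = M , λ m M≤m u v →
    ⇔.trans (CompAdj⇔≡-mod u v M≤m) (⇔.refl ×-⇔ mk⇔ ≡-mod⇒∣∣-∣ ∣∣-∣⇒≡-mod)

theoremA : (n : ℕ) → 2 ≤ n → (S T : List⁺ ℕ) →
  All (λ s → 1 ≤ s × s ≤ n ∸ 1) (toList S) →
  All (λ t → 1 ≤ t × t ≤ n ∸ 1) (toList T) →
  maxSet S + minSet T ≤ n →
  minSet S + maxSet T ≤ n →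
  let A = toeplitz n S T
      d = gcdList (sumSet S T)
      d′ = gcd d (minSet S)
  in (∃[ p ] (MatrixPeriod A p × p * d′ ≡ d))
     × CompetitionPeriod A 1
     × (∃[ M ] (∀ m → M ≤ m → (u v : Fin n) → CompAdj A m u v ⇔ CompAdj A M u v))
     × (∃[ M ] (∀ m → M ≤ m → (u v : Fin n) →
          CompAdj A m u v ⇔ (¬ (u ≡ v) × d ∣ ∣ toℕ u - toℕ v ∣)))
theoremA n _ S T S-bounds T-bounds maxS+minT≤n minS+maxT≤n =
  matrixPeriod , competitionPeriod , competitionGraph-stable , competitionGraph-classes
  where
  1≤minSet : ∀ L → All (λ s → 1 ≤ s × s ≤ n ∸ 1) (toList L) → 1 ≤ minSet L
  1≤minSet L bounds = proj₁ (All.lookup bounds (minSet-∈ L))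
  open ToeplitzDigraph n S T (1≤minSet S S-bounds) (1≤minSet T T-bounds) maxS+minT≤n minS+maxT≤n
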